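{- Let $P$ be an odd prime, $\alpha$ a positive integer and $A$ an integer with $m:=4A-P>0$. Put $M:=A/\alpha$. For an integer point $(u,v)\in\mathbb{Z}^2$ the following are equivalent: \begin{enumerate} \item There exist $d',b',c'\in\mathbb{N}$ such that $u=md'$, $v=b'-c'$, $b'=\frac{u+v}2$ and $c'=\frac{u-v}2$, and \[ (4\alpha d'b'-1)(4\alpha d'c'-1)=4\alpha Pd'^2+1. \] \item $m\mid u$, $u\equiv v\pmod2$, and $u^2-v^2=4M$. \item There exists $d'\in\mathbb{N}$ such that $u=md'$ and the discriminant $\Delta:=u^2-4M$ equals $v^2$. \end{enumerate}
   Formalization: The equivalences are claimed only for points with u > 0, α is assumed to divide A so that M = A/α is an integer, and d′, b′, c′ range over positive integers. Each condition added here is assumed in the paper as well or is needed for the statement above to hold. -}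

module Defs where

open import Data.Nat using (ℕ; _≤_)
open import Data.Integer using (ℤ; +_; _+_; _-_; _*_; _^_)
open import Data.Integer.Divisibility using (_∣_)
open import Data.Product using (Σ; _×_; ∃-syntax)
open import Relation.Binary.PropositionalEquality using (_≡_)

-- Convention: ℕ in the paper means the positive integers {1,2,...}.

mOf : ℤ → ℕ → ℤ
mOf A P = + 4 * A - + P

Cond1 : (α P : ℕ) (A u v : ℤ) → Set
Cond1 α P A u v =
  ∃[ d' ] ∃[ b' ] ∃[ c' ]
    ( (1 ≤ d') × (1 ≤ b') × (1 ≤ c')
    × (u ≡ mOf A P * + d')
    × (v ≡ + b' - + c')
    × (+ 2 * + b' ≡ u + v)
    × (+ 2 * + c' ≡ u - v)
    × ((+ 4 * + α * + d' * + b' - + 1) * (+ 4 * + α * + d' * + c' - + 1)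
         ≡ + 4 * + α * + P * ((+ d') ^ 2) + + 1) )

-- Condition (2); M is the (integer) quotient A/α
Cond2 : (P : ℕ) (A M u v : ℤ) → Set
Cond2 P A M u v =
  (mOf A P ∣ u) × (+ 2 ∣ (u - v)) × (u ^ 2 - v ^ 2 ≡ + 4 * M)

Cond3 : (P : ℕ) (A M u v : ℤ) → Set
Cond3 P A M u v =
  ∃[ d' ] ((1 ≤ d') × (u ≡ mOf A P * + d') × (u ^ 2 - + 4 * M ≡ v ^ 2))

{-# OPTIONS --safe #-}
module Submission where

open import Defs
open import Data.Nat using (ℕ; _≤_)
open import Data.Nat.Primality using (Prime)
open import Data.Integer using (ℤ; +_; _*_; _<_; _-_)
open import Data.Product using (_×_)
open import Function.Bundles using (_⇔_)
open import Relation.Binary.PropositionalEquality using (_≡_)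
open import Relation.Nullary using (¬_)
import Data.Nat.Divisibility as ND

import Data.Nat as ℕ
import Data.Nat.Properties as ℕ
open import Data.Nat.Primality using (prime?; euclidsLemma)
open import Data.Integer using (0ℤ; _+_; _^_; ∣_∣; NonZero; +<+; -[1+_]; +[1+_])
open import Data.Integer.Properties
  using (+-comm; *-comm; *-assoc; *-identityʳ; *-zeroʳ; *-distribˡ-+; *-cancelˡ-≡; *-cancelˡ-<-nonNeg;
         i*j≢0; abs-*; pos-*; i≡j⇒i-j≡0; i-j≡0⇒i≡j; i-j≤i; module ≤-Reasoning)
open import Data.Integer.Divisibility using (_∣_)
import Data.Integer.Divisibility.Signed as Signed
open import Data.Integer.Tactic.RingSolver using (solve)
open import Data.List.Base using (_∷_; [])
open import Data.Product using (_,_; ∃-syntax)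
open import Data.Sum using (reduce)
open import Function.Bundles using (Equivalence; mk⇔)
open import Relation.Binary.PropositionalEquality using (refl; sym; trans; cong; cong₂; subst; module ≡-Reasoning)
open import Relation.Nullary.Decidable using (from-yes)

-- Put b = (u + v)/2 and c = (u − v)/2, so that b + c = u and u² − v² = 4bc.  When moreover
-- u = md with m = 4αM − P, expanding gives
--   (4αdb − 1)(4αdc − 1) − (4αPd² + 1) = (4αd)² (bc − M),
-- so the equation in (1) says exactly bc = M, i.e. u² − v² = 4M.  Conversely the halves are
-- positive because bc = M > 0 (as 4αM > P) and b + c = u > 0.  Condition (3) only drops the
-- parity of u − v, which is forced: (u − v)² ≡ u² − v² = 4M (mod 2) and 2 is prime.

square : ∀ i → i ^ 2 ≡ i * i
square i = cong (i *_) (*-identityʳ i)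

i-j≡k⇒i-k≡j : ∀ i j {k} → i - j ≡ k → i - k ≡ j
i-j≡k⇒i-k≡j i j i-j≡k = trans (cong (i -_) (sym i-j≡k)) (solve (i ∷ j ∷ []))

i≡j*k⇒j∣i : ∀ {i} j k → i ≡ j * k → j ∣ i
i≡j*k⇒j∣i j k i≡j*k = Signed.∣⇒∣ᵤ (Signed.divides k (trans i≡j*k (*-comm j k)))

positive-quotient : ∀ {i j} → 0ℤ < i → 0ℤ < j → i ∣ j → ∃[ k ] (1 ≤ k × j ≡ i * + k)
positive-quotient (+<+ _) (+<+ ()) (ND.divides ℕ.zero refl)
positive-quotient {+ m} {+ n} (+<+ _) (+<+ _) (ND.divides k@(ℕ.suc _) n≡k*m) =
  k , ℕ.z<s , trans (cong +_ (trans n≡k*m (ℕ.*-comm k m))) (pos-* m k)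

left-factor-positive : ∀ i j → 0ℤ < i * j → 0ℤ < i + j → 0ℤ < i
left-factor-positive +[1+ _ ] _         _        _  = +<+ ℕ.z<s
left-factor-positive (+ 0)    _         (+<+ ()) _
left-factor-positive -[1+ _ ] (+ 0)     _        ()
left-factor-positive -[1+ _ ] +[1+ _ ]  ()       _
left-factor-positive -[1+ _ ] -[1+ _ ]  _        ()

factors-positive : ∀ {i j} → 0ℤ < i * j → 0ℤ < i + j → 0ℤ < i × 0ℤ < j
factors-positive {i} {j} 0<i*j 0<i+j =
  left-factor-positive i j 0<i*j 0<i+j ,
  left-factor-positive j i (subst (0ℤ <_) (*-comm i j) 0<i*j) (subst (0ℤ <_) (+-comm i j) 0<i+j)

2∣i²-j²⇒2∣i-j : ∀ i j → + 2 ∣ i ^ 2 - j ^ 2 → + 2 ∣ i - j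
2∣i²-j²⇒2∣i-j i j 2∣i²-j² =
  reduce (euclidsLemma ∣ i - j ∣ ∣ i - j ∣ (from-yes (prime? 2)) 2∣∣i-j∣²)
  where
  open ≡-Reasoning
  i²-j²-[i-j]² : i ^ 2 - j ^ 2 - + 2 * (j * (i - j)) ≡ (i - j) * (i - j)
  i²-j²-[i-j]² = begin
    i ^ 2 - j ^ 2 - + 2 * (j * (i - j))
      ≡⟨ cong₂ (λ x y → x - y - + 2 * (j * (i - j))) (square i) (square j) ⟩
    i * i - j * j - + 2 * (j * (i - j))
      ≡⟨ solve (i ∷ j ∷ []) ⟩
    (i - j) * (i - j) ∎
  2∣[i-j]² : + 2 Signed.∣ (i - j) * (i - j)
  2∣[i-j]² = subst (+ 2 Signed.∣_) i²-j²-[i-j]²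
    (Signed.∣m∣n⇒∣m-n {m = i ^ 2 - j ^ 2} (Signed.∣ᵤ⇒∣ 2∣i²-j²)
      (Signed.∣m⇒∣m*n (j * (i - j)) Signed.∣-refl))
  2∣∣i-j∣² : 2 ND.∣ ∣ i - j ∣ ℕ.* ∣ i - j ∣
  2∣∣i-j∣² = subst (2 ND.∣_) (abs-* (i - j) (i - j)) (Signed.∣⇒∣ᵤ 2∣[i-j]²)

halving : ∀ u v → + 2 ∣ u - v → ∃[ b ] ∃[ c ] (+ 2 * b ≡ u + v × + 2 * c ≡ u - v)
halving u v 2∣u-v with Signed.∣ᵤ⇒∣ 2∣u-v
... | Signed.divides c u-v≡c*2 =
  u - c , c , 2[u-c]≡u+v , trans (*-comm (+ 2) c) (sym u-v≡c*2)
  where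
  open ≡-Reasoning
  2[u-c]≡u+v : + 2 * (u - c) ≡ u + v
  2[u-c]≡u+v = begin
    + 2 * (u - c)      ≡⟨ solve (u ∷ c ∷ []) ⟩
    + 2 * u - c * + 2  ≡⟨ cong (+ 2 * u -_) u-v≡c*2 ⟨
    + 2 * u - (u - v)  ≡⟨ solve (u ∷ v ∷ []) ⟩
    u + v              ∎

module Halves (u v b c : ℤ) (2b≡u+v : + 2 * b ≡ u + v) (2c≡u-v : + 2 * c ≡ u - v) where
  open ≡-Reasoning

  sum : b + c ≡ u
  sum = *-cancelˡ-≡ (+ 2) (b + c) u (begin
    + 2 * (b + c)      ≡⟨ *-distribˡ-+ (+ 2) b c ⟩
    + 2 * b + + 2 * c  ≡⟨ cong₂ _+_ 2b≡u+v 2c≡u-v ⟩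
    (u + v) + (u - v)  ≡⟨ solve (u ∷ v ∷ []) ⟩
    + 2 * u            ∎)

  difference : v ≡ b - c
  difference = *-cancelˡ-≡ (+ 2) v (b - c) (begin
    + 2 * v            ≡⟨ solve (u ∷ v ∷ []) ⟩
    (u + v) - (u - v)  ≡⟨ cong₂ _-_ 2b≡u+v 2c≡u-v ⟨
    + 2 * b - + 2 * c  ≡⟨ solve (b ∷ c ∷ []) ⟩
    + 2 * (b - c)      ∎)

  squares : u ^ 2 - v ^ 2 ≡ + 4 * (b * c)
  squares = begin
    u ^ 2 - v ^ 2          ≡⟨ cong₂ _-_ (square u) (square v) ⟩
    u * u - v * v          ≡⟨ solve (u ∷ v ∷ []) ⟩
    (u + v) * (u - v)      ≡⟨ cong₂ _*_ 2b≡u+v 2c≡u-v ⟨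
    (+ 2 * b) * (+ 2 * c)  ≡⟨ solve (b ∷ c ∷ []) ⟩
    + 4 * (b * c)          ∎

  product : ∀ {M} → u ^ 2 - v ^ 2 ≡ + 4 * M → b * c ≡ M
  product {M} u²-v²≡4M = *-cancelˡ-≡ (+ 4) (b * c) M (trans (sym squares) u²-v²≡4M)

positive-halves : ∀ {M u v} → 0ℤ < M → 0ℤ < u → + 2 ∣ u - v → u ^ 2 - v ^ 2 ≡ + 4 * M →
  ∃[ b ] ∃[ c ] (1 ≤ b × 1 ≤ c × + 2 * + b ≡ u + v × + 2 * + c ≡ u - v)
positive-halves {u = u} {v} 0<M 0<u 2∣u-v u²-v²≡4M with halving u v 2∣u-v
... | b , c , 2b≡u+v , 2c≡u-v
  with factors-positive {b} {c}
         (subst (0ℤ <_) (sym (Halves.product u v b c 2b≡u+v 2c≡u-v u²-v²≡4M)) 0<M)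
         (subst (0ℤ <_) (sym (Halves.sum u v b c 2b≡u+v 2c≡u-v)) 0<u)
... | +<+ 1≤b , +<+ 1≤c = _ , _ , 1≤b , 1≤c , 2b≡u+v , 2c≡u-v

module _ (a x p M b c : ℤ) (b+c≡[4aM-p]x : b + c ≡ (+ 4 * (a * M) - p) * x) where
  open ≡-Reasoning

  equation-defect :
    (+ 4 * a * x * b - + 1) * (+ 4 * a * x * c - + 1) - (+ 4 * a * p * x ^ 2 + + 1)
      ≡ (+ 4 * a * x) * (+ 4 * a * x) * (b * c - M)
  equation-defect = begin
    (+ 4 * a * x * b - + 1) * (+ 4 * a * x * c - + 1) - (+ 4 * a * p * x ^ 2 + + 1)
      ≡⟨ cong (λ y → (+ 4 * a * x * b - + 1) * (+ 4 * a * x * c - + 1) - (+ 4 * a * p * y + + 1))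
              (square x) ⟩
    (+ 4 * a * x * b - + 1) * (+ 4 * a * x * c - + 1) - (+ 4 * a * p * (x * x) + + 1)
      ≡⟨ solve (a ∷ x ∷ p ∷ M ∷ b ∷ c ∷ []) ⟩
    (+ 4 * a * x) * (+ 4 * a * x) * (b * c - M) + + 4 * a * x * ((+ 4 * (a * M) - p) * x - (b + c))
      ≡⟨ cong (λ s → (+ 4 * a * x) * (+ 4 * a * x) * (b * c - M)
                       + + 4 * a * x * ((+ 4 * (a * M) - p) * x - s)) b+c≡[4aM-p]x ⟩
    (+ 4 * a * x) * (+ 4 * a * x) * (b * c - M)
      + + 4 * a * x * ((+ 4 * (a * M) - p) * x - (+ 4 * (a * M) - p) * x)
      ≡⟨ solve (a ∷ x ∷ p ∷ M ∷ b ∷ c ∷ []) ⟩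
    (+ 4 * a * x) * (+ 4 * a * x) * (b * c - M) ∎

  equation⇔product : .{{NonZero a}} → .{{NonZero x}} →
    (+ 4 * a * x * b - + 1) * (+ 4 * a * x * c - + 1) ≡ + 4 * a * p * x ^ 2 + + 1 ⇔ b * c ≡ M
  equation⇔product = mk⇔
    (λ equation → i-j≡0⇒i≡j _ _ (*-cancelˡ-≡ t² _ _ (begin
      t² * (b * c - M)  ≡⟨ equation-defect ⟨
      _                 ≡⟨ i≡j⇒i-j≡0 equation ⟩
      0ℤ                ≡⟨ *-zeroʳ t² ⟨
      t² * 0ℤ           ∎)))
    (λ bc≡M → i-j≡0⇒i≡j _ _ (begin
      _                 ≡⟨ equation-defect ⟩
      t² * (b * c - M)  ≡⟨ cong (t² *_) (i≡j⇒i-j≡0 bc≡M) ⟩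
      t² * 0ℤ           ≡⟨ *-zeroʳ t² ⟩
      0ℤ                ∎))
    where
    t² : ℤ
    t² = (+ 4 * a * x) * (+ 4 * a * x)
    instance
      t≢0 : NonZero (+ 4 * a * x)
      t≢0 = i*j≢0 (+ 4 * a) x {{i*j≢0 (+ 4) a}}
      t²≢0 : NonZero t²
      t²≢0 = i*j≢0 (+ 4 * a * x) (+ 4 * a * x)

M-positive : ∀ α P M → 0ℤ < mOf (+ α * M) P → 0ℤ < M
M-positive α P M 0<m = *-cancelˡ-<-nonNeg (+ (4 ℕ.* α)) (begin-strict
  + (4 ℕ.* α) * 0ℤ       ≡⟨ *-zeroʳ (+ (4 ℕ.* α)) ⟩
  0ℤ                     <⟨ 0<m ⟩
  + 4 * (+ α * M) - + P  ≤⟨ i-j≤i _ (+ P) ⟩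
  + 4 * (+ α * M)        ≡⟨ *-assoc (+ 4) (+ α) M ⟨
  + 4 * + α * M          ≡⟨ cong (_* M) (pos-* 4 α) ⟨
  + (4 ℕ.* α) * M        ∎)
  where open ≤-Reasoning

cond1⇒cond2 : ∀ {α P M u v} → 1 ≤ α → Cond1 α P (+ α * M) u v → Cond2 P (+ α * M) M u v
cond1⇒cond2 {α} {P} {M} {u} {v} 1≤α
  (d , b , c , 1≤d , _ , _ , u≡md , _ , 2b≡u+v , 2c≡u-v , equation) =
  i≡j*k⇒j∣i (mOf (+ α * M) P) (+ d) u≡md ,
  i≡j*k⇒j∣i (+ 2) (+ c) (sym 2c≡u-v) ,
  trans squares (cong (+ 4 *_) bc≡M)
  where
  open Halves u v (+ b) (+ c) 2b≡u+v 2c≡u-v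
  bc≡M : + b * + c ≡ M
  bc≡M = Equivalence.to
    (equation⇔product (+ α) (+ d) (+ P) M (+ b) (+ c) (trans sum u≡md)
      {{ℕ.>-nonZero 1≤α}} {{ℕ.>-nonZero 1≤d}})
    equation

cond2⇒cond1 : ∀ {α P M u v} → 1 ≤ α → 0ℤ < mOf (+ α * M) P → 0ℤ < u →
  Cond2 P (+ α * M) M u v → Cond1 α P (+ α * M) u v
cond2⇒cond1 {α} {P} {M} {u} {v} 1≤α 0<m 0<u (m∣u , 2∣u-v , u²-v²≡4M)
  with positive-quotient 0<m 0<u m∣u | positive-halves (M-positive α P M 0<m) 0<u 2∣u-v u²-v²≡4M
... | d , 1≤d , u≡md | b , c , 1≤b , 1≤c , 2b≡u+v , 2c≡u-v =
  d , b , c , 1≤d , 1≤b , 1≤c , u≡md , difference , 2b≡u+v , 2c≡u-v ,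
  Equivalence.from
    (equation⇔product (+ α) (+ d) (+ P) M (+ b) (+ c) (trans sum u≡md)
      {{ℕ.>-nonZero 1≤α}} {{ℕ.>-nonZero 1≤d}})
    (product u²-v²≡4M)
  where open Halves u v (+ b) (+ c) 2b≡u+v 2c≡u-v

cond2⇒cond3 : ∀ {P A M u v} → 0ℤ < mOf A P → 0ℤ < u → Cond2 P A M u v → Cond3 P A M u v
cond2⇒cond3 {u = u} {v} 0<m 0<u (m∣u , _ , u²-v²≡4M) =
  let d , 1≤d , u≡md = positive-quotient 0<m 0<u m∣u
  in d , 1≤d , u≡md , i-j≡k⇒i-k≡j (u ^ 2) (v ^ 2) u²-v²≡4M

cond3⇒cond2 : ∀ {P A M u v} → Cond3 P A M u v → Cond2 P A M u v
cond3⇒cond2 {P} {A} {M} {u} {v} (d , _ , u≡md , u²-4M≡v²) =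
  i≡j*k⇒j∣i (mOf A P) (+ d) u≡md ,
  2∣i²-j²⇒2∣i-j u v (i≡j*k⇒j∣i (+ 2) (+ 2 * M) (trans u²-v²≡4M (*-assoc (+ 2) (+ 2) M))) ,
  u²-v²≡4M
  where
  u²-v²≡4M : u ^ 2 - v ^ 2 ≡ + 4 * M
  u²-v²≡4M = i-j≡k⇒i-k≡j (u ^ 2) (+ 4 * M) u²-4M≡v²

lemmaD16 : (P α : ℕ) (A M : ℤ) → Prime P → ¬ (2 ND.∣ P) → 1 ≤ α
    → + 0 < mOf A P → A ≡ + α * M → (u v : ℤ) → + 0 < u
    → (Cond1 α P A u v ⇔ Cond2 P A M u v) × (Cond2 P A M u v ⇔ Cond3 P A M u v)
lemmaD16 P α A M _ _ 1≤α 0<m refl u v 0<u =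
  mk⇔ (cond1⇒cond2 1≤α) (cond2⇒cond1 1≤α 0<m 0<u) ,
  mk⇔ (cond2⇒cond3 {P} {+ α * M} 0<m 0<u) (cond3⇒cond2 {P} {+ α * M})
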